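{- Let $G=(U,V,E)$ be a bipartite graph, $F\subseteq E$, and let $(E_r,E_b)$ be an $(A,B,C)$-free bipartition of the set $E_c$ of committed edges of $G$; let $E_u=E\setminus E_c$ be the set of uncommitted edges. Then the subgraph $(U,V,E_b\cup E_u)$ of $G$ is a chain graph.
   Context: Let $\hat{E}=\{uv: u\in U, v\in V, uv\notin E\}$. A bipartite graph $(U,V,E')$ is a chain graph if there are no $u_1,u_2\in U$, $v_1,v_2\in V$ with $u_1v_1,u_2v_2\in E'$ and $u_1v_2,u_2v_1\notin E'$. Two edges $u_1v_1,u_2v_2\in E$ are in conflict in $G$ if $u_1v_2,u_2v_1\in\hat{E}$. An edge is committed if it is in conflict with some other edge of $E$, uncommitted otherwise. A bipartition of $E_c$ is a pair $(E_r,E_b)$ partitioning $E_c$ with $F\cap E_c\subseteq E_b$. Forbidden configurations on vertices $u_1,u_2\in U$, $v_1,v_2\in V$: $(A_1)$: $u_1v_1,u_2v_2\in E_r$, $u_1v_2,u_2v_1\in\hat{E}$; $(A_2)$: $u_1v_1,u_2v_2\in E_b$, $u_1v_2,u_2v_1\in\hat{E}$; $(B_1)$: $u_1v_1,u_2v_2\in E_r$, $u_1v_2\in\hat{E}$, $u_2v_1\in E_b$; $(B_2)$: $u_1v_1,u_2v_2\in E_b$, $u_1v_2\in\hat{E}$, $u_2v_1\in E_r$; $(C)$: $u_1v_1,u_2v_2\in E_r$, $u_1v_2\in\hat{E}$, $u_2v_1\in F$. The bipartition is $(A,B,C)$-free if it contains none of these five configurations. -}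

module Defs where

open import Data.Nat using (ℕ)
open import Data.Fin using (Fin)
open import Data.Product using (_×_; ∃-syntax)
open import Data.Sum using (_⊎_)
open import Data.Empty using (⊥)
open import Relation.Nullary using (¬_)
open import Relation.Binary using (REL; Decidable)
open import Level using (0ℓ)

-- A finite bipartite graph G = (U, V, E) with U = Fin m, V = Fin n and
-- edge set E given as a (decidable) relation U → V → Set.
EdgeSet : ℕ → ℕ → Set₁
EdgeSet m n = REL (Fin m) (Fin n) 0ℓ

module _ {m n : ℕ} where

  _⊆ᴱ_ : EdgeSet m n → EdgeSet m n → Set
  A ⊆ᴱ B = ∀ u v → A u v → B u v

  _∪ᴱ_ : EdgeSet m n → EdgeSet m n → EdgeSet m n
  (A ∪ᴱ B) u v = A u v ⊎ B u v

  Ehat : EdgeSet m n → EdgeSet m n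
  Ehat E u v = ¬ E u v

  IsChainGraph : EdgeSet m n → Set
  IsChainGraph E' = ¬ (∃[ u₁ ] ∃[ u₂ ] ∃[ v₁ ] ∃[ v₂ ]
    (E' u₁ v₁ × E' u₂ v₂ × ¬ E' u₁ v₂ × ¬ E' u₂ v₁))

  InConflict : EdgeSet m n → Fin m → Fin n → Fin m → Fin n → Set
  InConflict E u₁ v₁ u₂ v₂ =
    E u₁ v₁ × E u₂ v₂ × Ehat E u₁ v₂ × Ehat E u₂ v₁

  -- committed edges E_c (an edge in conflict with some other edge of E;
  -- an edge can never be in conflict with itself)
  Committed : EdgeSet m n → EdgeSet m n
  Committed E u v = E u v × ∃[ u' ] ∃[ v' ] InConflict E u v u' v'

  Uncommitted : EdgeSet m n → EdgeSet m n
  Uncommitted E u v = E u v × ¬ Committed E u v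

  record IsBipartition (E F Er Eb : EdgeSet m n) : Set where
    field
      cover    : ∀ u v → Committed E u v → Er u v ⊎ Eb u v
      r⊆c      : Er ⊆ᴱ Committed E
      b⊆c      : Eb ⊆ᴱ Committed E
      disjoint : ∀ u v → Er u v → Eb u v → ⊥
      F∩Ec⊆Eb  : ∀ u v → F u v → Committed E u v → Eb u v

  ConfA₁ ConfA₂ ConfB₁ ConfB₂ ConfC :
    (E F Er Eb : EdgeSet m n) → Fin m → Fin m → Fin n → Fin n → Set
  ConfA₁ E F Er Eb u₁ u₂ v₁ v₂ =
    Er u₁ v₁ × Er u₂ v₂ × Ehat E u₁ v₂ × Ehat E u₂ v₁
  ConfA₂ E F Er Eb u₁ u₂ v₁ v₂ =
    Eb u₁ v₁ × Eb u₂ v₂ × Ehat E u₁ v₂ × Ehat E u₂ v₁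
  ConfB₁ E F Er Eb u₁ u₂ v₁ v₂ =
    Er u₁ v₁ × Er u₂ v₂ × Ehat E u₁ v₂ × Eb u₂ v₁
  ConfB₂ E F Er Eb u₁ u₂ v₁ v₂ =
    Eb u₁ v₁ × Eb u₂ v₂ × Ehat E u₁ v₂ × Er u₂ v₁
  ConfC E F Er Eb u₁ u₂ v₁ v₂ =
    Er u₁ v₁ × Er u₂ v₂ × Ehat E u₁ v₂ × F u₂ v₁

  IsABCFree : (E F Er Eb : EdgeSet m n) → Set
  IsABCFree E F Er Eb = ∀ u₁ u₂ v₁ v₂ →
      ¬ ConfA₁ E F Er Eb u₁ u₂ v₁ v₂
    × ¬ ConfA₂ E F Er Eb u₁ u₂ v₁ v₂
    × ¬ ConfB₁ E F Er Eb u₁ u₂ v₁ v₂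
    × ¬ ConfB₂ E F Er Eb u₁ u₂ v₁ v₂
    × ¬ ConfC  E F Er Eb u₁ u₂ v₁ v₂

module Submission where

-- The red edges are exactly the committed edges outside H = E_b ∪ E_u, and
-- every red edge has a blue conflict partner (A₁).  An edge of H that is in
-- conflict with some edge is committed, hence blue; so no edge of H conflicts
-- with a blue edge (A₂).  Given a crossing u₁v₁, u₂v₂ ∈ H with u₁v₂, u₂v₁ ∉ H,
-- the missing cross pairs that are edges are red; chasing their blue partners
-- through these two facts ends in one of the configurations A₂, B₁, B₂.

open import Defs
open import Data.Nat using (ℕ)
open import Data.Fin using (Fin)
open import Data.Product using (_×_; _,_; proj₁; ∃-syntax)
open import Data.Sum using (inj₁; inj₂)
open import Data.Empty using (⊥; ⊥-elim)
open import Relation.Nullary using (¬_; yes; no)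
open import Relation.Binary using (Decidable)

module ChainGraph {m n : ℕ} (E F Er Eb : EdgeSet m n)
  (E? : Decidable E) (Er? : Decidable Er)
  (bip : IsBipartition E F Er Eb) (free : IsABCFree E F Er Eb) where

  open IsBipartition bip

  H : EdgeSet m n
  H = Eb ∪ᴱ Uncommitted E

  committed : ∀ {u v} x y → E u v → E x y → ¬ E u y → ¬ E x v → Committed E u v
  committed x y uv xy u≁y x≁v = uv , x , y , uv , xy , u≁y , x≁v

  H⊆E : ∀ {u v} → H u v → E u v
  H⊆E {u} {v} (inj₁ blue) = proj₁ (b⊆c u v blue)
  H⊆E (inj₂ (uv , _))     = uv

  noA₁ : ∀ u₁ u₂ v₁ v₂ → Er u₁ v₁ → Er u₂ v₂ → ¬ E u₁ v₂ → ¬ E u₂ v₁ → ⊥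
  noA₁ u₁ u₂ v₁ v₂ p q r s with free u₁ u₂ v₁ v₂
  ... | a₁ , _ = a₁ (p , q , r , s)

  noA₂ : ∀ u₁ u₂ v₁ v₂ → Eb u₁ v₁ → Eb u₂ v₂ → ¬ E u₁ v₂ → ¬ E u₂ v₁ → ⊥
  noA₂ u₁ u₂ v₁ v₂ p q r s with free u₁ u₂ v₁ v₂
  ... | _ , a₂ , _ = a₂ (p , q , r , s)

  noB₁ : ∀ u₁ u₂ v₁ v₂ → Er u₁ v₁ → Er u₂ v₂ → ¬ E u₁ v₂ → Eb u₂ v₁ → ⊥
  noB₁ u₁ u₂ v₁ v₂ p q r s with free u₁ u₂ v₁ v₂
  ... | _ , _ , b₁ , _ = b₁ (p , q , r , s)

  noB₂ : ∀ u₁ u₂ v₁ v₂ → Eb u₁ v₁ → Eb u₂ v₂ → ¬ E u₁ v₂ → Er u₂ v₁ → ⊥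
  noB₂ u₁ u₂ v₁ v₂ p q r s with free u₁ u₂ v₁ v₂
  ... | _ , _ , _ , b₂ , _ = b₂ (p , q , r , s)

  H-conflict⇒Eb : ∀ {u v} x y → H u v → E x y → ¬ E u y → ¬ E x v → Eb u v
  H-conflict⇒Eb x y (inj₁ blue)             _  _   _   = blue
  H-conflict⇒Eb x y (inj₂ (uv , uncommitted)) xy u≁y x≁v =
    ⊥-elim (uncommitted (committed x y uv xy u≁y x≁v))

  H-conflict-Eb⇒⊥ : ∀ {u v x y} → H u v → Eb x y → ¬ E u y → ¬ E x v → ⊥
  H-conflict-Eb⇒⊥ {u} {v} {x} {y} uv xy u≁y x≁v =
    noA₂ u x v y (H-conflict⇒Eb x y uv (proj₁ (b⊆c x y xy)) u≁y x≁v) xy u≁y x≁v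

  E∖H⇒Er : ∀ {u v} → E u v → ¬ H u v → Er u v
  E∖H⇒Er {u} {v} uv uv∉H with Er? u v
  ... | yes red = red
  ... | no ¬red = ⊥-elim (uv∉H (inj₂ (uv , uncommitted)))
    where
    uncommitted : ¬ Committed E u v
    uncommitted c with cover u v c
    ... | inj₁ red  = ¬red red
    ... | inj₂ blue = uv∉H (inj₁ blue)

  Er⇒blue-partner : ∀ {u v} → Er u v →
    ∃[ a ] ∃[ b ] Eb a b × ¬ E u b × ¬ E a v
  Er⇒blue-partner {u} {v} red with r⊆c u v red
  ... | uv , a , b , _ , ab , u≁b , a≁v with cover a b (committed u v ab uv a≁v u≁b)
  ...   | inj₁ ab-red  = ⊥-elim (noA₁ u a v b red ab-red u≁b a≁v)
  ...   | inj₂ ab-blue = a , b , ab-blue , u≁b , a≁v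

  -- The partner ab of the red cross edge u₁v₂ cannot conflict with the H-edges
  -- u₁v₁ and u₂v₂, which forces the two cross edges u₂b and av₁ into E.
  crossing-partner : ∀ {u₁ u₂ v₁ v₂} → H u₁ v₁ → H u₂ v₂ → Er u₁ v₂ →
    ∃[ a ] ∃[ b ] Eb a b × ¬ E u₁ b × ¬ E a v₂ × E u₂ b × E a v₁
  crossing-partner {u₁} {u₂} {v₁} {v₂} h₁ h₂ red
    with Er⇒blue-partner red
  ... | a , b , ab , u₁≁b , a≁v₂ with E? u₂ b | E? a v₁
  ...   | no u₂≁b | _        = ⊥-elim (H-conflict-Eb⇒⊥ h₂ ab u₂≁b a≁v₂)
  ...   | yes _   | no a≁v₁  = ⊥-elim (H-conflict-Eb⇒⊥ h₁ ab u₁≁b a≁v₁)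
  ...   | yes u₂b | yes av₁  = a , b , ab , u₁≁b , a≁v₂ , u₂b , av₁

  one-red-cross⇒⊥ : ∀ {u₁ u₂ v₁ v₂} → H u₁ v₁ → H u₂ v₂ →
    Er u₁ v₂ → ¬ E u₂ v₁ → ⊥
  one-red-cross⇒⊥ {u₁} {u₂} {v₁} {v₂} h₁ h₂ red u₂≁v₁
    with crossing-partner h₁ h₂ red
  ... | a , b , _ , u₁≁b , a≁v₂ , u₂b , av₁ =
    noB₂ u₂ u₁ v₂ v₁ (H-conflict⇒Eb a v₁ h₂ av₁ u₂≁v₁ a≁v₂)
                     (H-conflict⇒Eb u₂ b h₁ u₂b u₁≁b u₂≁v₁) u₂≁v₁ red

  -- ab and cd are the partners given by crossing-partner for the red cross
  -- edges u₁v₂ and u₂v₁; the edge u₂b conflicts with u₁d.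
  two-red-cross-diagonal⇒⊥ : ∀ {u₁ u₂ v₁ v₂ a b c d} →
    H u₁ v₁ → H u₂ v₂ → Er u₁ v₂ → Er u₂ v₁ →
    ¬ E u₁ b → ¬ E a v₂ → E u₂ b →
    Eb c d → ¬ E u₂ d → ¬ E c v₁ → E u₁ d →
    E a d → ⊥
  two-red-cross-diagonal⇒⊥ {u₁} {u₂} {v₁} {v₂} {a} {b} {c} {d}
    h₁ h₂ red₁ red₂ u₁≁b a≁v₂ u₂b cd u₂≁d c≁v₁ u₁d ad
    with cover u₂ b (committed u₁ d u₂b u₁d u₂≁d u₁≁b)
  ... | inj₁ u₂b-red =
    noB₁ u₁ u₂ v₂ b red₁ u₂b-red u₁≁b (H-conflict⇒Eb a d h₂ ad u₂≁d a≁v₂)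
  ... | inj₂ u₂b-blue with E? c b
  ...   | no c≁b = noA₂ u₂ c b d u₂b-blue cd u₂≁d c≁b
  ...   | yes cb = noB₂ u₁ u₂ v₁ b (H-conflict⇒Eb c b h₁ cb u₁≁b c≁v₁)
                                   u₂b-blue u₁≁b red₂

  two-red-cross⇒⊥ : ∀ {u₁ u₂ v₁ v₂} → H u₁ v₁ → H u₂ v₂ →
    Er u₁ v₂ → Er u₂ v₁ → ⊥
  two-red-cross⇒⊥ h₁ h₂ red₁ red₂
    with crossing-partner h₁ h₂ red₁ | crossing-partner h₂ h₁ red₂
  ... | a , b , ab , u₁≁b , a≁v₂ , u₂b , _ | c , d , cd , u₂≁d , c≁v₁ , u₁d , _
    with E? a d | E? c b
  ...   | yes ad | _      = two-red-cross-diagonal⇒⊥ h₁ h₂ red₁ red₂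
                              u₁≁b a≁v₂ u₂b cd u₂≁d c≁v₁ u₁d ad
  ...   | no _   | yes cb = two-red-cross-diagonal⇒⊥ h₂ h₁ red₂ red₁
                              u₂≁d c≁v₁ u₁d ab u₁≁b a≁v₂ u₂b cb
  ...   | no a≁d | no c≁b = noA₂ _ _ _ _ ab cd a≁d c≁b

  H-isChainGraph : IsChainGraph H
  H-isChainGraph (u₁ , u₂ , v₁ , v₂ , h₁ , h₂ , u₁v₂∉H , u₂v₁∉H)
    with E? u₁ v₂ | E? u₂ v₁
  ... | no u₁≁v₂ | no u₂≁v₁ =
    H-conflict-Eb⇒⊥ h₁ (H-conflict⇒Eb u₁ v₁ h₂ (H⊆E h₁) u₂≁v₁ u₁≁v₂) u₁≁v₂ u₂≁v₁
  ... | yes u₁v₂ | no u₂≁v₁ = one-red-cross⇒⊥ h₁ h₂ (E∖H⇒Er u₁v₂ u₁v₂∉H) u₂≁v₁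
  ... | no u₁≁v₂ | yes u₂v₁ = one-red-cross⇒⊥ h₂ h₁ (E∖H⇒Er u₂v₁ u₂v₁∉H) u₁≁v₂
  ... | yes u₁v₂ | yes u₂v₁ =
    two-red-cross⇒⊥ h₁ h₂ (E∖H⇒Er u₁v₂ u₁v₂∉H) (E∖H⇒Er u₂v₁ u₂v₁∉H)

lemma4 : {m n : ℕ} (E F Er Eb : EdgeSet m n) →
    Decidable E → Decidable F → Decidable Er → Decidable Eb →
    F ⊆ᴱ E →
    IsBipartition E F Er Eb →
    IsABCFree E F Er Eb →
    IsChainGraph (Eb ∪ᴱ Uncommitted E)
lemma4 E F Er Eb E? _ Er? _ _ bip free =
  ChainGraph.H-isChainGraph E F Er Eb E? Er? bip free
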